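{- Let $(E,\mathcal{S})$ be a $\tau$-SNC set system with positive costs, $\bigcup_{S\in\mathcal{S}}S=E$, and layer decomposition $Z_1,\dots,Z_L$, and run the forward phase described in the context, producing $(\mathcal{A},\alpha)$, the sets $R_1,\dots,R_L$, and the partition $\mathcal{A}=\mathcal{A}_1\cup\dots\cup\mathcal{A}_L$ where $\mathcal{A}_k$ is the collection of sets added to $\mathcal{A}$ during epoch $k$. For $1\le k\le L$ let $F_k$ be the set of elements covered by $\mathcal{A}_k$ but not covered by $\mathcal{A}_1\cup\dots\cup\mathcal{A}_{k-1}$. Then: (i) for $1\le k\le L$, $F_k\subseteq Z_k\cup Z_{k+1}\cup\dots\cup Z_L$; (ii) for $1\le k\le L$, no set of $\mathcal{A}_k$ contains an element of $R_{k+1}\cup R_{k+2}\cup\dots\cup R_L$; (iii) every element $e$ whose dual variable $\alpha(e)$ was raised during the forward phase belongs to $R_1\cup R_2\cup\dots\cup R_L$.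
   Context: Definitions: for $X\subseteq E$ and $e\in X$, with $\mathcal{Q}$ the sets containing $e$, $e$ is a $\tau$-SNC element within $X$ if for every $\mathcal{P}\subseteq\mathcal{Q}$ there are $S_1,\dots,S_r\in\mathcal{P}$, $r\le\tau$, with $\bigcup_{S\in\mathcal{P}}(S\cap X)=\bigcup_{i=1}^r(S_i\cap X)$; the system is $\tau$-SNC if every nonempty $X\subseteq E$ contains such an element. Layer decomposition: $Z_1$ is the set of $\tau$-SNC elements within $E$, $Z_k$ the set of $\tau$-SNC elements within $E\setminus(Z_1\cup\dots\cup Z_{k-1})$, until no elements remain. Forward phase: initialize $\mathcal{A}=\emptyset$ and $\alpha(e)=0$ for all $e$. For epochs $k=1,\dots,L$: let $R_k$ be the elements of $Z_k$ not covered by $\mathcal{A}$ at the start of epoch $k$; run iterations $j=1,2,\dots$ as long as some element of $R_k$ is uncovered by $\mathcal{A}$. In iteration $j$, the participating sets are those $S\notin\mathcal{A}$ and the participating elements are those $e\in R_k$ not covered by $\mathcal{A}$. For each participating set $S$ let $d_j(S)$ be the number of participating elements in $S$, $c_j(S)=w(S)-\sum_{e\in S}\alpha(e)$ and $p_j(S)=c_j(S)/d_j(S)$ (taken as $+\infty$ if $d_j(S)=0$). For each participating element $e$, let $q_j(e)=\min_{S\ni e}p_j(S)$ and increase $\alpha(e)$ by $q_j(e)$ (all simultaneously). Then every participating set $S$ with $\sum_{e\in S}\alpha(e)\ge w(S)/8$ is added to $\mathcal{A}$. -}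

module Defs where

open import Data.Nat as ℕ using (ℕ; zero; suc)
open import Data.Fin using (Fin; zero; suc; toℕ; inject₁) renaming (_<_ to _<ᶠ_; _≤_ to _≤ᶠ_)
open import Data.Bool using (Bool; true; false; _∧_; _∨_; not; if_then_else_)
open import Data.Maybe using (Maybe; just; nothing)
open import Data.List using (List; length)
open import Data.List.Membership.Propositional using (_∈_)
open import Data.List.Relation.Unary.All using (All)
open import Data.Integer as ℤ using (ℤ)
open import Data.Rational using (ℚ; 0ℚ; _+_; _-_; _*_; _/_; _≤ᵇ_; _⊓_; _<_)
open import Data.Product using (Σ; ∃; _×_; _,_)
open import Function.Bundles using (_⇔_)

anyFin : ∀ {k} → (Fin k → Bool) → Bool
anyFin {zero}  f = false
anyFin {suc k} f = f zero ∨ anyFin (λ i → f (suc i))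

sumFin : ∀ {k} → (Fin k → ℚ) → ℚ
sumFin {zero}  f = 0ℚ
sumFin {suc k} f = f zero + sumFin (λ i → f (suc i))

countFin : ∀ {k} → (Fin k → Bool) → ℕ
countFin {zero}  f = zero
countFin {suc k} f = (if f zero then 1 else 0) ℕ.+ countFin (λ i → f (suc i))

-- minimum with `nothing` playing the role of +∞
minM : Maybe ℚ → Maybe ℚ → Maybe ℚ
minM nothing  y        = y
minM (just x) nothing  = just x
minM (just x) (just y) = just (x ⊓ y)

minFin : ∀ {k} → (Fin k → Maybe ℚ) → Maybe ℚ
minFin {zero}  f = nothing
minFin {suc k} f = minM (f zero) (minFin (λ i → f (suc i)))

-- Set systems: ground set E = Fin n, sets S₀ … S_{m-1} (indexed family),
-- subsets of E (and of the family) represented by Bool-valued functions.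

Subset : ℕ → Set
Subset k = Fin k → Bool

record SetSystem (n m : ℕ) : Set where
  field
    set  : Fin m → Subset n
    cost : Fin m → ℚ

open SetSystem public

SNCWithin : ∀ {n m} → ℕ → SetSystem n m → Subset n → Fin n → Set
SNCWithin {n} {m} τ 𝒮 X e =
  X e ≡' true ×
  ((P : Subset m) → (∀ s → P s ≡' true → set 𝒮 s e ≡' true) →
    Σ (List (Fin m)) λ Ss →
      (length Ss ℕ.≤ τ) ×
      All (λ s → P s ≡' true) Ss ×
      (∀ x → (∃ λ s → P s ≡' true × set 𝒮 s x ≡' true × X x ≡' true)
           ⇔ (∃ λ s → s ∈ Ss × set 𝒮 s x ≡' true × X x ≡' true)))
  where open import Relation.Binary.PropositionalEquality renaming (_≡_ to _≡'_)

open import Relation.Binary.PropositionalEquality using (_≡_)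

IsSNCSystem : ∀ {n m} → ℕ → SetSystem n m → Set
IsSNCSystem {n} τ 𝒮 =
  (X : Subset n) → (∃ λ x → X x ≡ true) → ∃ λ e → X e ≡ true × SNCWithin τ 𝒮 X e

-- Layer decomposition Z₁ … Z_L  (here indexed by Fin L, i.e. Z_0 … Z_{L-1})

remaining : ∀ {n L} → (Fin L → Subset n) → Fin L → Subset n
remaining Z k e = not (anyFin (λ i → if toℕ i ℕ.<ᵇ toℕ k then Z i e else false))

record IsLayerDecomposition {n m} (τ : ℕ) (𝒮 : SetSystem n m)
                            (L : ℕ) (Z : Fin L → Subset n) : Set where
  field
    layer     : ∀ k e → (Z k e ≡ true) ⇔ SNCWithin τ 𝒮 (remaining Z k) e
    -- the procedure runs while elements remain …
    nonEmpty  : ∀ k → ∃ λ e → remaining Z k e ≡ true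
    -- … and stops when no element remains
    exhausted : ∀ e → ∃ λ k → Z k e ≡ true

record State (n m : ℕ) : Set where
  constructor ⟨_,_,_⟩
  field
    𝒜      : Subset m
    α      : Fin n → ℚ
    raised : Subset n

open State public

module _ {n m : ℕ} (𝒮 : SetSystem n m) where

  coveredB : Subset m → Subset n
  coveredB A e = anyFin (λ s → A s ∧ set 𝒮 s e)

  load : (Fin n → ℚ) → Fin m → ℚ
  load α s = sumFin (λ e → if set 𝒮 s e then α e else 0ℚ)

  iteration : Subset n → State n m → State n m
  iteration R st = ⟨ A' , α' , raised' ⟩
    where
      A = 𝒜 st
      α₀ = α st
      partElem : Subset n
      partElem e = R e ∧ not (coveredB A e)
      partSet : Subset m
      partSet s = not (A s)
      d : Fin m → ℕ
      d s = countFin (λ e → set 𝒮 s e ∧ partElem e)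
      c : Fin m → ℚ
      c s = cost 𝒮 s - load α₀ s
      pOf : ℚ → ℕ → Maybe ℚ
      pOf x zero    = nothing
      pOf x (suc k) = just (x * (ℤ.+ 1 / suc k))
      p : Fin m → Maybe ℚ
      p s = pOf (c s) (d s)
      q : Fin n → Maybe ℚ
      q e = minFin (λ s → if partSet s ∧ set 𝒮 s e then p s else nothing)
      incr : Maybe ℚ → ℚ → ℚ
      incr (just x) a = a + x
      incr nothing  a = a       -- never happens for participating elements
      α' : Fin n → ℚ
      α' e = if partElem e then incr (q e) (α₀ e) else α₀ e
      A' : Subset m
      A' s = A s ∨ (partSet s ∧ (cost 𝒮 s * (ℤ.+ 1 / 8) ≤ᵇ load α' s))
      raised' : Subset n
      raised' e = raised st e ∨ not (α' e ≤ᵇ α₀ e)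

  data EpochRun (R : Subset n) : State n m → State n m → Set where
    done : ∀ {st} → (∀ e → R e ≡ true → coveredB (𝒜 st) e ≡ true) →
           EpochRun R st st
    step : ∀ {st st'} e → R e ≡ true → coveredB (𝒜 st) e ≡ false →
           EpochRun R (iteration R st) st' → EpochRun R st st'

  initialState : State n m
  initialState = ⟨ (λ _ → false) , (λ _ → 0ℚ) , (λ _ → false) ⟩

  Rset : ∀ {L} → (Fin L → Subset n) → (Fin (suc L) → State n m) → Fin L → Subset n
  Rset Z st k e = Z k e ∧ not (coveredB (𝒜 (st (inject₁ k))) e)

  -- st k = state at the start of epoch k; st L = final state
  record ForwardRun {L} (Z : Fin L → Subset n) (st : Fin (suc L) → State n m) : Set where
    field
      start  : st zero ≡ initialState
      epochs : ∀ k → EpochRun (Rset Z st k) (st (inject₁ k)) (st (suc k))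

  addedIn : ∀ {L} → (Fin (suc L) → State n m) → Fin L → Subset m
  addedIn st k s = 𝒜 (st (suc k)) s ∧ not (𝒜 (st (inject₁ k)) s)

  -- F_k : covered by 𝒜_k but not by 𝒜_1 ∪ … ∪ 𝒜_{k-1} (= 𝒜 at start of epoch k)
  Fset : ∀ {L} → (Fin (suc L) → State n m) → Fin L → Subset n
  Fset st k e = coveredB (addedIn st k) e ∧ not (coveredB (𝒜 (st (inject₁ k))) e)

module Submission where

-- Proposition 2 is a statement about the bookkeeping of the forward phase;
-- it rests on three monotonicity facts and needs none of the quantitative
-- hypotheses (SNC, positive costs, the dual-update rule).
--
--   * The collection 𝒜 only grows: an iteration only adds sets, so along
--     an epoch and then along the whole run (a chain of states indexed by
--     Fin (suc L)) the collection at an earlier time is contained in the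
--     collection at a later time; hence coverage is monotone in time.
--   * At the end of epoch j every element of Z_j is covered: either it
--     was covered at the start of the epoch, or it lies in R_j and the
--     epoch only stops once R_j is covered.
--   * An iteration of epoch k only raises α on elements of R_k.
--
-- (i) then follows because an element of Z_j with j < k is already covered
-- when epoch k starts, (ii) because a set of 𝒜_k is present when epoch
-- j > k starts, while R_j consists of elements uncovered at that moment,
-- and (iii) by induction along the run.

open import Defs
open import Data.Nat using (ℕ; suc)
open import Data.Fin using (Fin; zero; fromℕ) renaming (_<_ to _<ᶠ_; _≤_ to _≤ᶠ_)
open import Data.Bool using (Bool; true; false)
open import Data.Rational using (ℚ; 0ℚ; _<_)
open import Data.Product using (∃; _×_)
open import Relation.Binary.PropositionalEquality using (_≡_)

open import Data.Nat as ℕ using (z≤n; s≤s)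
import Data.Nat.Properties as ℕ
open import Data.Fin using (inject₁) renaming (suc to fsuc)
open import Data.Fin.Properties using (toℕ-inject₁; _≤?_)
open import Data.Bool using (_∧_; _∨_; not)
open import Data.Bool.Properties using (T-≡; ∨-identityʳ)
open import Data.Product using (_,_; proj₁; proj₂)
open import Data.Sum using (_⊎_; inj₁; inj₂)
open import Function using (_∘_)
open import Function.Bundles using (Equivalence)
open import Relation.Binary.Core using (Rel)
open import Relation.Binary.Definitions using (Reflexive; Transitive)
open import Relation.Nullary using (yes; no)
open import Relation.Binary.PropositionalEquality using (refl; subst; sym)
open import Data.Rational using (_≤ᵇ_)
import Data.Rational.Properties as ℚ

∧-true : ∀ {a b} → a ∧ b ≡ true → a ≡ true × b ≡ true
∧-true {true} b≡true = refl , b≡true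

not-true : ∀ {a} → not a ≡ true → a ≡ false
not-true {false} _ = refl

∨-introˡ : ∀ {a} b → a ≡ true → a ∨ b ≡ true
∨-introˡ b refl = refl

true≢false : ∀ {a} → a ≡ true → a ≡ false → ∀ {p} {P : Set p} → P
true≢false refl ()

anyFin-intro : ∀ {k} (f : Fin k → Bool) (i : Fin k) → f i ≡ true → anyFin f ≡ true
anyFin-intro f zero     fi≡true rewrite fi≡true = refl
anyFin-intro f (fsuc i) fi≡true with f zero
... | true  = refl
... | false = anyFin-intro (f ∘ fsuc) i fi≡true

anyFin-elim : ∀ {k} (f : Fin k → Bool) → anyFin f ≡ true → ∃ λ i → f i ≡ true
anyFin-elim {suc k} f any≡true with f zero in f0
... | true  = zero , f0
... | false with anyFin-elim (f ∘ fsuc) any≡true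
...   | i , fi = fsuc i , fi

-- The rational comparison `_≤ᵇ_` is reflexive; it shows that leaving a
-- dual variable unchanged does not count as raising it.

≤ᵇ-refl : ∀ (q : ℚ) → (q ≤ᵇ q) ≡ true
≤ᵇ-refl q = Equivalence.to T-≡ (ℚ.≤⇒≤ᵇ (ℚ.≤-refl {q}))

-- Chains indexed by Fin (suc L): times 0, …, L, where step k leads
-- from time inject₁ k to time fsuc k.
-- Both are proved by shifting the chain by one step (f ∘ fsuc), which keeps
-- the recursion structural because inject₁ (fsuc k) = fsuc (inject₁ k).

chain-induction : ∀ {p} {L} (P : Fin (suc L) → Set p) →
  P zero → (∀ k → P (inject₁ k) → P (fsuc k)) → ∀ i → P i
chain-induction P base advance zero = base
chain-induction {L = suc L} P base advance (fsuc i) =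
  chain-induction (P ∘ fsuc) (advance zero base) (advance ∘ fsuc) i

chain-monotone : ∀ {a r} {A : Set a} (_⊑_ : Rel A r) → Reflexive _⊑_ → Transitive _⊑_ →
  ∀ {L} (f : Fin (suc L) → A) → (∀ k → f (inject₁ k) ⊑ f (fsuc k)) →
  ∀ {i j} → i ≤ᶠ j → f i ⊑ f j
chain-monotone _⊑_ refl′ trans′ f advance {zero}   {zero}   _ = refl′
chain-monotone _⊑_ refl′ trans′ {L = suc L} f advance {zero} {fsuc j} _ =
  trans′ (advance zero) (chain-monotone _⊑_ refl′ trans′ (f ∘ fsuc) (advance ∘ fsuc) {zero} {j} z≤n)
chain-monotone _⊑_ refl′ trans′ {L = suc L} f advance {fsuc i} {fsuc j} (s≤s i≤j) =
  chain-monotone _⊑_ refl′ trans′ (f ∘ fsuc) (advance ∘ fsuc) {i} {j} i≤j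

<⇒fsuc≤inject₁ : ∀ {L} {i j : Fin L} → i <ᶠ j → fsuc i ≤ᶠ inject₁ j
<⇒fsuc≤inject₁ {j = j} i<j = subst (ℕ._≤_ _) (sym (toℕ-inject₁ j)) i<j

-- Inclusion of collections of sets, which Defs represents as Bool-valued
-- functions on the index set (rather than as the Vec-based Data.Fin.Subset).

_⊆_ : ∀ {m} → Subset m → Subset m → Set
A ⊆ B = ∀ s → A s ≡ true → B s ≡ true

⊆-refl : ∀ {m} → Reflexive (_⊆_ {m})
⊆-refl s s∈A = s∈A

⊆-trans : ∀ {m} → Transitive (_⊆_ {m})
⊆-trans A⊆B B⊆C s s∈A = B⊆C s (A⊆B s s∈A)

module Epochs {n m : ℕ} (𝒮 : SetSystem n m) where

  covered-by-member : ∀ {A} s e → A s ≡ true → set 𝒮 s e ≡ true → coveredB 𝒮 A e ≡ true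
  covered-by-member {A} s e s∈A e∈s =
    anyFin-intro (λ s → A s ∧ set 𝒮 s e) s (subst (λ b → b ∧ _ ≡ true) (sym s∈A) e∈s)

  covered-mono : ∀ {A B} → A ⊆ B → ∀ e → coveredB 𝒮 A e ≡ true → coveredB 𝒮 B e ≡ true
  covered-mono {A} A⊆B e e-covered with anyFin-elim (λ s → A s ∧ set 𝒮 s e) e-covered
  ... | s , s∈A∧e∈s with ∧-true s∈A∧e∈s
  ...   | s∈A , e∈s = covered-by-member s e (A⊆B s s∈A) e∈s

  -- An epoch only adds sets to the collection: each iteration replaces
  -- the collection A by A ∨ (newly tight sets).
  epoch-grows : ∀ {R a b} → EpochRun 𝒮 R a b → 𝒜 a ⊆ 𝒜 b
  epoch-grows (done _)           = ⊆-refl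
  epoch-grows (step _ _ _ later) = ⊆-trans (λ s → ∨-introˡ _) (epoch-grows later)

  epoch-covers : ∀ {R a b} → EpochRun 𝒮 R a b → ∀ e → R e ≡ true → coveredB 𝒮 (𝒜 b) e ≡ true
  epoch-covers (done all-covered) = all-covered
  epoch-covers (step _ _ _ later) = epoch-covers later

  -- An iteration of an epoch with element set R only raises α on R:
  -- outside R the dual variable is left unchanged.
  iteration-raises-only-R : ∀ R st e → raised (iteration 𝒮 R st) e ≡ true →
    raised st e ≡ true ⊎ R e ≡ true
  iteration-raises-only-R R st e raised′ with R e
  ... | true  = inj₂ refl
  ... | false rewrite ≤ᵇ-refl (α st e) | ∨-identityʳ (raised st e) = inj₁ raised′

  epoch-raises-only-R : ∀ {R a b} → EpochRun 𝒮 R a b → ∀ e → raised b e ≡ true →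
    raised a e ≡ true ⊎ R e ≡ true
  epoch-raises-only-R (done _) e raised-b = inj₁ raised-b
  epoch-raises-only-R {R} (step {st} _ _ _ later) e raised-b
    with epoch-raises-only-R later e raised-b
  ... | inj₂ e∈R    = inj₂ e∈R
  ... | inj₁ raised′ = iteration-raises-only-R R st e raised′

module ForwardPhase {n m L : ℕ} (𝒮 : SetSystem n m) (Z : Fin L → Subset n)
                    (st : Fin (suc L) → State n m) (run : ForwardRun 𝒮 Z st) where
  open Epochs 𝒮
  open ForwardRun run

  collection-grows : ∀ {i j} → i ≤ᶠ j → 𝒜 (st i) ⊆ 𝒜 (st j)
  collection-grows = chain-monotone _⊆_ ⊆-refl ⊆-trans (𝒜 ∘ st) (epoch-grows ∘ epochs)

  layer-covered : ∀ j e → Z j e ≡ true → coveredB 𝒮 (𝒜 (st (fsuc j))) e ≡ true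
  layer-covered j e e∈Z with coveredB 𝒮 (𝒜 (st (inject₁ j))) e in covered-before
  ... | true  = covered-mono (epoch-grows (epochs j)) e covered-before
  ... | false = epoch-covers (epochs j) e e∈R
    where
      e∈R : Rset 𝒮 Z st j e ≡ true
      e∈R rewrite e∈Z | covered-before = refl

  -- An element of Z_j with j < k is covered after epoch j, hence already
  -- at the start of epoch k, so it cannot be newly covered in epoch k.
  newly-covered-in-later-layers : (∀ e → ∃ λ k → Z k e ≡ true) →
    ∀ k e → Fset 𝒮 st k e ≡ true → ∃ λ j → k ≤ᶠ j × Z j e ≡ true
  newly-covered-in-later-layers exhausted k e e∈F with exhausted e
  ... | j , e∈Z with k ≤? j
  ...   | yes k≤j = j , k≤j , e∈Z
  ...   | no  k≰j = true≢false covered-at-start (not-true (proj₂ (∧-true e∈F)))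
    where
      covered-at-start : coveredB 𝒮 (𝒜 (st (inject₁ k))) e ≡ true
      covered-at-start = covered-mono (collection-grows (<⇒fsuc≤inject₁ (ℕ.≰⇒> k≰j)))
                                      e (layer-covered j e e∈Z)

  -- Part (ii): no set of 𝒜_k contains an element of R_j for j > k, since
  -- such a set is present when epoch j starts, while R_j consists of the
  -- elements uncovered at that moment.
  added-sets-avoid-later-R : ∀ k s → addedIn 𝒮 st k s ≡ true →
    ∀ j → k <ᶠ j → ∀ e → Rset 𝒮 Z st j e ≡ true → set 𝒮 s e ≡ false
  added-sets-avoid-later-R k s s∈𝒜ₖ j k<j e e∈R with set 𝒮 s e in e∈s
  ... | false = refl
  ... | true  = true≢false covered-at-start (not-true (proj₂ (∧-true e∈R)))
    where
      s-present : 𝒜 (st (inject₁ j)) s ≡ true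
      s-present = collection-grows (<⇒fsuc≤inject₁ k<j) s (proj₁ (∧-true s∈𝒜ₖ))
      covered-at-start : coveredB 𝒮 (𝒜 (st (inject₁ j))) e ≡ true
      covered-at-start = covered-by-member s e s-present e∈s

  -- The invariant behind part (iii): at time i every raised element lies
  -- in some R_k.  It holds initially (nothing is raised) and is preserved
  -- by epoch k, which only raises α on R_k.
  RaisedWithinR : Fin (suc L) → Set
  RaisedWithinR i = ∀ e → raised (st i) e ≡ true → ∃ λ k → Rset 𝒮 Z st k e ≡ true

  raised-within-R : ∀ i → RaisedWithinR i
  raised-within-R = chain-induction RaisedWithinR nothing-raised-initially epoch-step
    where
      nothing-raised-initially : RaisedWithinR zero
      nothing-raised-initially e raised₀ rewrite start = true≢false raised₀ refl
      epoch-step : ∀ k → RaisedWithinR (inject₁ k) → RaisedWithinR (fsuc k)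
      epoch-step k before e raised-after with epoch-raises-only-R (epochs k) e raised-after
      ... | inj₁ raised-before = before e raised-before
      ... | inj₂ e∈Rₖ         = k , e∈Rₖ

proposition2 : ∀ {n m : ℕ} (τ : ℕ) (𝒮 : SetSystem n m) →
    IsSNCSystem τ 𝒮 →
    (∀ s → 0ℚ < cost 𝒮 s) →
    (∀ e → ∃ λ s → set 𝒮 s e ≡ true) →
    (L : ℕ) (Z : Fin L → Subset n) → IsLayerDecomposition τ 𝒮 L Z →
    (st : Fin (suc L) → State n m) → ForwardRun 𝒮 Z st →
    ((∀ k e → Fset 𝒮 st k e ≡ true → ∃ λ j → k ≤ᶠ j × Z j e ≡ true)
    × (∀ k s → addedIn 𝒮 st k s ≡ true →
         ∀ j → k <ᶠ j → ∀ e → Rset 𝒮 Z st j e ≡ true → set 𝒮 s e ≡ false)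
    × (∀ e → raised (st (fromℕ L)) e ≡ true → ∃ λ k → Rset 𝒮 Z st k e ≡ true))
proposition2 _ 𝒮 _ _ _ L Z layers st run =
    newly-covered-in-later-layers (IsLayerDecomposition.exhausted layers)
  , added-sets-avoid-later-R
  , raised-within-R (fromℕ L)
  where open ForwardPhase 𝒮 Z st run
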